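{- For every decreasing tableau $P$, removable cell $(r,c)$ of $P$ and $\alpha\in\{0,1\}$, the reverse insertion $\Psi(P,(r,c),\alpha)=(P',m)$ is well-defined; in particular $P'$ is a decreasing tableau (of shape $\mathrm{shape}(P)$ if $\alpha=0$ and $\mathrm{shape}(P)\setminus\{(r,c)\}$ if $\alpha=1$).
   Context: Tableaux use English notation; cell $(i,j)$ is in row $i$, column $j$. A decreasing tableau is a filling of the diagram of a partition by positive integers strictly decreasing from left to right along rows and from top to bottom along columns. A cell is removable if it is the last cell of its row and the bottom cell of its column. $P_{>r}$ denotes the tableau obtained by deleting the first $r$ rows of $P$ (rows renumbered from 1). A value $x$ is $P$-ejectable if $x$ occurs in the first row of $P$ and either $x-1$ does not occur in the first row, or $x-1$ occurs in the first row and $x-1$ is $P_{>1}$-ejectable (nothing is ejectable in the empty tableau). Bumping path of a removable cell $(r,c)$ of $P$: $m_r$ is the entry at $(r,c)$, and for $i=r-1,\dots,1$, $m_i$ is the smallest entry of row $i$ with $m_i>m_{i+1}$. Reverse insertion $\Psi(P,(r,c),\alpha)=(P',m)$: compute the bumping path $m_r<\dots<m_1$; set $m:=m_1$, $P':=P$. If $\alpha=1$, delete cell $(r,c)$ from $P'$, set $\alpha_r=1$, and process rows $i=r-1,\dots,1$. If $\alpha=0$, set $m_{r+1}=0$, $\alpha_{r+1}=0$, and process rows $i=r,\dots,1$. Processing row $i$ with $R$ the set of entries of row $i$ of $P$: (D) if $m_i-1\in R$, leave row $i$, $\alpha_i=\alpha_{i+1}$; (DR) else if $\alpha_{i+1}=1$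 and $m_{i+1}\notin R$, replace $m_i$ in row $i$ of $P'$ by $m_{i+1}$, $\alpha_i=1$; otherwise let $x$ be the smallest $P'_{>i}$-ejectable value (current $P'$) with $m_{i+1}<x<m_i$: (IR) if $x$ exists replace $m_i$ by $x$, $\alpha_i=1$; (NR) else leave row $i$, $\alpha_i=0$. Output final $P'$ and $m$. -}

module Defs where

open import Data.Nat using (ℕ; zero; suc; _∸_; _<_; _≤_; _+_; _≡ᵇ_; _<ᵇ_)
open import Data.Bool using (Bool; true; false; not; _∧_; _∨_; if_then_else_)
open import Data.Bool.ListAction using (any)
open import Data.List using (List; []; _∷_; length; drop; filterᵇ; applyUpTo; head; map)
open import Data.List.Relation.Unary.All using (All)
open import Data.Maybe using (Maybe; just; nothing; _>>=_)
open import Data.Product using (_×_; _,_; Σ)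
open import Relation.Binary.PropositionalEquality using (_≡_)

-- A tableau is the list of its rows (top to bottom), each row a list of
-- entries (left to right).  Internal indices are 0-based.
Tab : Set
Tab = List (List ℕ)

nth : {A : Set} → List A → ℕ → Maybe A
nth []       _       = nothing
nth (x ∷ xs) zero    = just x
nth (x ∷ xs) (suc i) = nth xs i

entry : Tab → ℕ → ℕ → Maybe ℕ
entry T i j = nth T i >>= λ row → nth row j

modAt : {A : Set} → ℕ → (A → A) → List A → List A
modAt _       f []       = []
modAt zero    f (x ∷ xs) = f x ∷ xs
modAt (suc i) f (x ∷ xs) = x ∷ modAt i f xs

removeAtℕ : {A : Set} → ℕ → List A → List A
removeAtℕ _       []       = []
removeAtℕ zero    (x ∷ xs) = xs
removeAtℕ (suc i) (x ∷ xs) = x ∷ removeAtℕ i xs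

record IsDecreasingTableau (T : Tab) : Set where
  field
    rowsNonempty : All (λ row → 0 < length row) T
    shapePartition : ∀ i row row' → nth T i ≡ just row → nth T (suc i) ≡ just row' →
                     length row' ≤ length row
    positive : ∀ i j v → entry T i j ≡ just v → 0 < v
    rowStrict : ∀ i j u v → entry T i j ≡ just u → entry T i (suc j) ≡ just v → v < u
    colStrict : ∀ i j u v → entry T i j ≡ just u → entry T (suc i) j ≡ just v → v < u

-- Removable cell (r,c), 1-based as in the paper: row r has exactly c cells,
-- and there is no cell (r+1,c).
Removable : Tab → ℕ → ℕ → Set
Removable T r c =
  (1 ≤ r) × (1 ≤ c) ×
  (Σ (List ℕ) λ row → (nth T (r ∸ 1) ≡ just row) × (length row ≡ c)) ×
  (entry T r (c ∸ 1) ≡ nothing)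

-- shape (list of row lengths) with the last cell of (1-based) row r removed
shapeDel : List ℕ → ℕ → List ℕ
shapeDel []       _             = []
shapeDel (x ∷ xs) (suc zero)    with x ∸ 1
... | zero  = xs
... | suc y = suc y ∷ xs
shapeDel (x ∷ xs) (suc (suc r)) = x ∷ shapeDel xs (suc r)
shapeDel (x ∷ xs) zero          = x ∷ xs

elemᵇ : ℕ → List ℕ → Bool
elemᵇ x = any (λ y → x ≡ᵇ y)

ejectable : Tab → ℕ → Bool
ejectable []           x = false
ejectable (row ∷ rest) x =
  elemᵇ x row ∧ (not (elemᵇ (x ∸ 1) row) ∨ (elemᵇ (x ∸ 1) row ∧ ejectable rest (x ∸ 1)))

smallestAbove : List ℕ → ℕ → Maybe ℕ
smallestAbove []       m = nothing
smallestAbove (x ∷ xs) m with m <ᵇ x | smallestAbove xs m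
... | false | r        = r
... | true  | nothing  = just x
... | true  | just y   = just (if y <ᵇ x then y else x)

replaceVal : ℕ → ℕ → List ℕ → List ℕ
replaceVal a b []       = []
replaceVal a b (x ∷ xs) = if x ≡ᵇ a then b ∷ xs else x ∷ replaceVal a b xs

smallestIn : (ℕ → Bool) → ℕ → ℕ → Maybe ℕ
smallestIn p lo hi = head (filterᵇ p (applyUpTo (λ t → suc lo + t) (hi ∸ suc lo)))

-- Process (0-based) row k.  P original tableau, P' current, R = row k of P,
-- mi = m_i, mn = m_{i+1}, a = α_{i+1}.  Returns new P' and α_i.
processRow : Tab → ℕ → List ℕ → ℕ → ℕ → Bool → Tab × Bool
processRow P' k R mi mn a =
  if elemᵇ (mi ∸ 1) R then (P' , a)
  else if a ∧ not (elemᵇ mn R) then (modAt k (replaceVal mi mn) P' , true)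
  else ir (smallestIn (ejectable (drop (suc k) P')) mn mi)
  where
    ir : Maybe ℕ → Tab × Bool
    ir (just x) = (modAt k (replaceVal mi x) P' , true)
    ir nothing  = (P' , false)

-- process rows k, k-1, ..., 0 (0-based), with mi = m at row k,
-- mn = m at row k+1, a = α at row k+1.
sweep : Tab → Tab → ℕ → ℕ → ℕ → Bool → Maybe (Tab × ℕ)
sweep P P' zero mi mn a =
  nth P zero >>= λ R → just (Data.Product.proj₁ (processRow P' zero R mi mn a) , mi)
sweep P P' (suc k) mi mn a =
  nth P (suc k) >>= λ R →
  let res = processRow P' (suc k) R mi mn a in
  nth P k >>= λ R' →
  smallestAbove R' mi >>= λ m' →
  sweep P (Data.Product.proj₁ res) k m' mi (Data.Product.proj₂ res)

deleteCell : Tab → ℕ → ℕ → Tab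
deleteCell []         _       j = []
deleteCell (row ∷ T)  zero    j with removeAtℕ j row
... | []      = T
... | x ∷ xs  = (x ∷ xs) ∷ T
deleteCell (row ∷ T)  (suc k) j = row ∷ deleteCell T k j

-- Ψ(P,(r,c),α) with (r,c) 1-based, α ∈ {0,1} encoded as false/true.
-- Returns nothing when some step is undefined.
Ψ : Tab → ℕ → ℕ → Bool → Maybe (Tab × ℕ)
Ψ P zero    c α = nothing
Ψ P (suc k) c false = entry P k (c ∸ 1) >>= λ mr → sweep P P k mr 0 false
Ψ P (suc k) c true  = entry P k (c ∸ 1) >>= λ mr → go k mr
  where
    P1 : Tab
    P1 = deleteCell P k (c ∸ 1)
    go : ℕ → ℕ → Maybe (Tab × ℕ)
    go zero     mr = just (P1 , mr)
    go (suc k') mr = nth P k' >>= λ R' → smallestAbove R' mr >>= λ m' → sweep P P1 k' m' mr true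

-- Ψ changes the tableau only by deleting the corner cell or by replacing the
-- bump value mᵢ in row i by some y with mᵢ₊₁ ≤ y < mᵢ.  The left and upper
-- neighbours of mᵢ exceed mᵢ, and its right neighbour is at most mᵢ₊₁ since
-- mᵢ is the least entry of row i above mᵢ₊₁; so only the cell below needs an
-- argument.  The bump path moves weakly right going up, and the current
-- tableau holds at most mᵢ₊₁ below mᵢ, strictly less when αᵢ₊₁ = 1 and mᵢ₊₁
-- does not occur in row i, which is what rule (DR) requires.  The one delicate
-- case is a rule (D) step in row i + 1 leaving mᵢ₊₁ in place: then mᵢ₊₁ − 1
-- occurs in row i + 1, and if mᵢ₊₁ is missing from row i this forces mᵢ
-- strictly to the right of mᵢ₊₁.

module Submission where

open import Defs
open import Data.Nat using (ℕ; zero; suc; _∸_; _<_; _≤_; _+_; _≡ᵇ_; _<ᵇ_; z≤n; s≤s; _≟_; _<?_; _≤?_)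
open import Data.Nat.Properties
open import Data.Bool using (Bool; true; false; if_then_else_; T)
open import Data.Unit using (tt)
open import Data.List using (List; []; _∷_; map; length; drop; filterᵇ; applyUpTo; head)
open import Data.List.Properties using (∷-injectiveˡ; ∷-injectiveʳ)
open import Data.List.Relation.Unary.All using (All; []; _∷_)
open import Data.Maybe using (Maybe; just; nothing; _>>=_)
open import Data.Maybe.Properties using (just-injective)
open import Data.Product using (Σ; ∃; _×_; _,_; proj₁; proj₂)
open import Data.Sum using (_⊎_; inj₁; inj₂)
open import Data.Empty using (⊥-elim)
open import Relation.Nullary using (yes; no)
open import Relation.Binary.PropositionalEquality

just≢nothing : ∀ {A : Set} {x : A} → just x ≢ nothing
just≢nothing ()

nth-length : ∀ {A : Set} (xs : List A) j {v} → nth xs j ≡ just v → j < length xs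
nth-length (x ∷ xs) zero    _ = s≤s z≤n
nth-length (x ∷ xs) (suc j) e = s≤s (nth-length xs j e)

nth-defined : ∀ {A : Set} (xs : List A) j → j < length xs → ∃ λ v → nth xs j ≡ just v
nth-defined (x ∷ xs) zero    _         = x , refl
nth-defined (x ∷ xs) (suc j) (s≤s j<n) = nth-defined xs j j<n

nth-defined-≤ : ∀ {A : Set} (xs : List A) {i j v} → i ≤ j → nth xs j ≡ just v → ∃ λ u → nth xs i ≡ just u
nth-defined-≤ xs {i} {j} i≤j e = nth-defined xs i (≤-<-trans i≤j (nth-length xs j e))

nth-undefined⇒length≤ : ∀ {A : Set} (xs : List A) j → nth xs j ≡ nothing → length xs ≤ j
nth-undefined⇒length≤ []       j       _ = z≤n
nth-undefined⇒length≤ (x ∷ xs) (suc j) e = s≤s (nth-undefined⇒length≤ xs j e)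

All-nth : ∀ {A : Set} {p : A → Set} {xs : List A} → All p xs → ∀ i {x} → nth xs i ≡ just x → p x
All-nth (px ∷ _)  zero    refl = px
All-nth (_  ∷ ps) (suc i) e    = All-nth ps i e

nth⇒All : ∀ {A : Set} {p : A → Set} (xs : List A) → (∀ i {x} → nth xs i ≡ just x → p x) → All p xs
nth⇒All []       _ = []
nth⇒All (x ∷ xs) f = f zero refl ∷ nth⇒All xs (λ i → f (suc i))

entry-nth : ∀ T i {R} j → nth T i ≡ just R → entry T i j ≡ nth R j
entry-nth T i j e rewrite e = refl

entry⇒nth : ∀ T i j {v} → entry T i j ≡ just v → ∃ λ R → nth T i ≡ just R × nth R j ≡ just v
entry⇒nth T i j e with nth T i
... | just R = R , refl , e

entry-cong : ∀ T T' i j → nth T' i ≡ nth T i → entry T' i j ≡ entry T i j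
entry-cong T T' i j = cong (_>>= λ R → nth R j)

nth-sameShape : ∀ {T' T : Tab} → map length T' ≡ map length T →
                ∀ i {R'} → nth T' i ≡ just R' → ∃ λ R → nth T i ≡ just R × length R' ≡ length R
nth-sameShape {_ ∷ _} {R ∷ _} same zero    refl = R , refl , ∷-injectiveˡ same
nth-sameShape {_ ∷ _} {_ ∷ _} same (suc i) e    = nth-sameShape (∷-injectiveʳ same) i e

rowsNonempty-sameShape : ∀ {T' T : Tab} → map length T' ≡ map length T →
                         All (λ R → 0 < length R) T → All (λ R → 0 < length R) T'
rowsNonempty-sameShape {[]}     {_}     _    _        = []
rowsNonempty-sameShape {_ ∷ _} {_ ∷ _} same (p ∷ ps) =
  subst (0 <_) (sym (∷-injectiveˡ same)) p ∷ rowsNonempty-sameShape (∷-injectiveʳ same) ps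

shapePartition-sameShape : ∀ {T' T : Tab} → map length T' ≡ map length T → IsDecreasingTableau T →
  ∀ i R R' → nth T' i ≡ just R → nth T' (suc i) ≡ just R' → length R' ≤ length R
shapePartition-sameShape same dT i _ _ e e'
  with nth-sameShape same i e | nth-sameShape same (suc i) e'
... | R , f , l | R' , f' , l' rewrite l | l' = IsDecreasingTableau.shapePartition dT i R R' f f'

Decreasing : List ℕ → Set
Decreasing R = ∀ j {u v} → nth R j ≡ just u → nth R (suc j) ≡ just v → v < u

row-decreasing : ∀ {T} → IsDecreasingTableau T → ∀ i {R} → nth T i ≡ just R → Decreasing R
row-decreasing {T} dT i e j eu ev =
  IsDecreasingTableau.rowStrict dT i j _ _ (trans (entry-nth T i j e) eu) (trans (entry-nth T i (suc j) e) ev)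

decreasing-< : ∀ R → Decreasing R → ∀ {i j u v} → i < j → nth R i ≡ just u → nth R j ≡ just v → v < u
decreasing-< R dR {i} {suc j} (s≤s i≤j) ei ej with nth-defined-≤ R (n≤1+n j) ej | m≤n⇒m<n∨m≡n i≤j
... | w , ew | inj₁ i<j  = <-trans (dR j ew ej) (decreasing-< R dR i<j ei ew)
... | w , ew | inj₂ refl = subst (_ <_) (just-injective (trans (sym ew) ei)) (dR j ew ej)

decreasing-≤ : ∀ R → Decreasing R → ∀ {i j u v} → i ≤ j → nth R i ≡ just u → nth R j ≡ just v → v ≤ u
decreasing-≤ R dR i≤j ei ej with m≤n⇒m<n∨m≡n i≤j
... | inj₁ i<j  = <⇒≤ (decreasing-< R dR i<j ei ej)
... | inj₂ refl = ≤-reflexive (just-injective (trans (sym ej) ei))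

decreasing-<⁻¹ : ∀ R → Decreasing R → ∀ i j {u v} → nth R i ≡ just u → nth R j ≡ just v → v < u → i < j
decreasing-<⁻¹ R dR i j ei ej v<u with i <? j
... | yes i<j = i<j
... | no  i≮j = ⊥-elim (<⇒≱ v<u (decreasing-≤ R dR (≮⇒≥ i≮j) ej ei))

≡ᵇ-refl : ∀ n → (n ≡ᵇ n) ≡ true
≡ᵇ-refl zero    = refl
≡ᵇ-refl (suc n) = ≡ᵇ-refl n

≡ᵇ-true⇒≡ : ∀ m n → (m ≡ᵇ n) ≡ true → m ≡ n
≡ᵇ-true⇒≡ m n e = ≡ᵇ⇒≡ m n (subst T (sym e) tt)

≢⇒≡ᵇ-false : ∀ m n → m ≢ n → (m ≡ᵇ n) ≡ false
≢⇒≡ᵇ-false m n m≢n with m ≡ᵇ n in e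
... | true  = ⊥-elim (m≢n (≡ᵇ-true⇒≡ m n e))
... | false = refl

<ᵇ-true⇒< : ∀ m n → (m <ᵇ n) ≡ true → m < n
<ᵇ-true⇒< m n e = <ᵇ⇒< m n (subst T (sym e) tt)

<ᵇ-false⇒≥ : ∀ m n → (m <ᵇ n) ≡ false → n ≤ m
<ᵇ-false⇒≥ m n e = ≮⇒≥ (λ m<n → subst T e (<⇒<ᵇ m<n))

elemᵇ-true⇒nth : ∀ x R → elemᵇ x R ≡ true → ∃ λ j → nth R j ≡ just x
elemᵇ-true⇒nth x (y ∷ ys) e with x ≡ᵇ y in x≡ᵇy
... | true  = zero , cong just (sym (≡ᵇ-true⇒≡ x y x≡ᵇy))
... | false with elemᵇ-true⇒nth x ys e
...   | j , ej = suc j , ej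

elemᵇ-false⇒nth : ∀ x R → elemᵇ x R ≡ false → ∀ j → nth R j ≢ just x
elemᵇ-false⇒nth x (y ∷ ys) e j ej with x ≡ᵇ y in x≡ᵇy
elemᵇ-false⇒nth x (y ∷ ys) () j ej        | true
elemᵇ-false⇒nth x (y ∷ ys) e  zero refl   | false with () ← trans (sym (≡ᵇ-refl x)) x≡ᵇy
elemᵇ-false⇒nth x (y ∷ ys) e  (suc j) ej  | false = elemᵇ-false⇒nth x ys e j ej

smallestAbove-∈ : ∀ R m {m'} → smallestAbove R m ≡ just m' → ∃ λ j → nth R j ≡ just m' × m < m'
smallestAbove-∈ (x ∷ xs) m e with m <ᵇ x in m<x | smallestAbove xs m in found
... | false | just y with smallestAbove-∈ xs m found
...   | j , ej , lt rewrite just-injective e = suc j , ej , lt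
smallestAbove-∈ (x ∷ xs) m refl | true | nothing = zero , refl , <ᵇ-true⇒< m x m<x
smallestAbove-∈ (x ∷ xs) m e | true | just y with y <ᵇ x
... | true with smallestAbove-∈ xs m found
...   | j , ej , lt rewrite just-injective e = suc j , ej , lt
smallestAbove-∈ (x ∷ xs) m refl | true | just y | false = zero , refl , <ᵇ-true⇒< m x m<x

smallestAbove-nothing : ∀ R m → smallestAbove R m ≡ nothing → ∀ j {v} → nth R j ≡ just v → v ≤ m
smallestAbove-nothing (x ∷ xs) m e j ej with m <ᵇ x in m<x | smallestAbove xs m in found
smallestAbove-nothing (x ∷ xs) m e zero    refl | false | _ = <ᵇ-false⇒≥ m x m<x
smallestAbove-nothing (x ∷ xs) m e (suc j) ej   | false | _ = smallestAbove-nothing xs m (trans found e) j ej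
smallestAbove-nothing (x ∷ xs) m () j       ej   | true  | nothing
smallestAbove-nothing (x ∷ xs) m () j       ej   | true  | just _

smallestAbove-defined : ∀ R m j {v} → nth R j ≡ just v → m < v → ∃ λ m' → smallestAbove R m ≡ just m'
smallestAbove-defined R m j ej m<v with smallestAbove R m in found
... | just m' = m' , refl
... | nothing = ⊥-elim (<⇒≱ m<v (smallestAbove-nothing R m found j ej))

smallestAbove-least : ∀ R m {m'} → smallestAbove R m ≡ just m' → ∀ j {v} → nth R j ≡ just v → m < v → m' ≤ v
smallestAbove-least (x ∷ xs) m e j ej m<v with m <ᵇ x in m<x | smallestAbove xs m in found
smallestAbove-least (x ∷ xs) m e    zero    refl m<v | false | _ = ⊥-elim (<⇒≱ m<v (<ᵇ-false⇒≥ m x m<x))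
smallestAbove-least (x ∷ xs) m e    (suc j) ej   m<v | false | _ = smallestAbove-least xs m (trans found e) j ej m<v
smallestAbove-least (x ∷ xs) m refl zero    refl m<v | true  | nothing = ≤-refl
smallestAbove-least (x ∷ xs) m refl (suc j) ej   m<v | true  | nothing =
  ⊥-elim (<⇒≱ m<v (smallestAbove-nothing xs m found j ej))
smallestAbove-least (x ∷ xs) m e    j       ej   m<v | true  | just y with y <ᵇ x in y<x
smallestAbove-least (x ∷ xs) m refl zero    refl m<v | true | just y | true  = <⇒≤ (<ᵇ-true⇒< y x y<x)
smallestAbove-least (x ∷ xs) m refl (suc j) ej   m<v | true | just y | true  = smallestAbove-least xs m found j ej m<v
smallestAbove-least (x ∷ xs) m refl zero    refl m<v | true | just y | false = ≤-refl
smallestAbove-least (x ∷ xs) m refl (suc j) ej   m<v | true | just y | false =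
  ≤-trans (<ᵇ-false⇒≥ y x y<x) (smallestAbove-least xs m found j ej m<v)

head-filterᵇ : ∀ (p : ℕ → Bool) xs {x} → head (filterᵇ p xs) ≡ just x → ∃ λ j → nth xs j ≡ just x
head-filterᵇ p (y ∷ ys) e with p y
... | true  = zero , e
... | false with head-filterᵇ p ys e
...   | j , ej = suc j , ej

nth-applyUpTo : ∀ (f : ℕ → ℕ) n j {x} → nth (applyUpTo f n) j ≡ just x → j < n × f j ≡ x
nth-applyUpTo f (suc n) zero    e = s≤s z≤n , just-injective e
nth-applyUpTo f (suc n) (suc j) e with nth-applyUpTo (λ t → f (suc t)) n j e
... | j<n , fj≡x = s≤s j<n , fj≡x

smallestIn-bounds : ∀ p lo hi {x} → smallestIn p lo hi ≡ just x → lo < x × x < hi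
smallestIn-bounds p lo hi e with head-filterᵇ p (applyUpTo (λ t → suc lo + t) (hi ∸ suc lo)) e
... | j , ej with nth-applyUpTo (λ t → suc lo + t) (hi ∸ suc lo) j ej
...   | j<n , refl with suc lo ≤? hi
...     | yes lo<hi = s≤s (m≤m+n lo j) , subst (suc lo + j <_) (m+[n∸m]≡n lo<hi) (+-monoʳ-< (suc lo) j<n)
...     | no  lo≮hi = ⊥-elim (n≮0 (subst (j <_) (m≤n⇒m∸n≡0 (<⇒≤ (≰⇒> lo≮hi))) j<n))

-- Replacing one entry

replaceVal-length : ∀ a b R → length (replaceVal a b R) ≡ length R
replaceVal-length a b []       = refl
replaceVal-length a b (x ∷ xs) with x ≡ᵇ a
... | true  = refl
... | false = cong suc (replaceVal-length a b xs)

-- replaceVal acts on the first occurrence, so it must be known to be at j.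
FirstAt : ℕ → ℕ → List ℕ → Set
FirstAt a j R = nth R j ≡ just a × (∀ i {u} → i < j → nth R i ≡ just u → a < u)

firstAt-tail : ∀ {a j x xs} → FirstAt a (suc j) (x ∷ xs) → FirstAt a j xs
firstAt-tail (at , before) = at , λ i i<j → before (suc i) (s≤s i<j)

firstAt-head : ∀ {a j x xs} → FirstAt a (suc j) (x ∷ xs) → (x ≡ᵇ a) ≡ false
firstAt-head {a} {x = x} (_ , before) = ≢⇒≡ᵇ-false x a (λ x≡a → <-irrefl (sym x≡a) (before zero (s≤s z≤n) refl))

nth-replaceVal-≡ : ∀ a b R j → FirstAt a j R → nth (replaceVal a b R) j ≡ just b
nth-replaceVal-≡ a b (x ∷ xs) zero    (refl , _) rewrite ≡ᵇ-refl x = refl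
nth-replaceVal-≡ a b (x ∷ xs) (suc j) first rewrite firstAt-head first =
  nth-replaceVal-≡ a b xs j (firstAt-tail first)

nth-replaceVal-≢ : ∀ a b R j → FirstAt a j R → ∀ j' → j' ≢ j → nth (replaceVal a b R) j' ≡ nth R j'
nth-replaceVal-≢ a b (x ∷ xs) zero    (refl , _) zero     j'≢j = ⊥-elim (j'≢j refl)
nth-replaceVal-≢ a b (x ∷ xs) zero    (refl , _) (suc j') j'≢j rewrite ≡ᵇ-refl x = refl
nth-replaceVal-≢ a b (x ∷ xs) (suc j) first      j'       j'≢j rewrite firstAt-head first with j'
... | zero     = refl
... | suc j'' = nth-replaceVal-≢ a b xs j (firstAt-tail first) j'' (λ eq → j'≢j (cong suc eq))

nth-modAt-≢ : ∀ {A : Set} k (f : A → A) T i → i ≢ k → nth (modAt k f T) i ≡ nth T i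
nth-modAt-≢ k       f []      i       _   = refl
nth-modAt-≢ zero    f (x ∷ T) zero    i≢k = ⊥-elim (i≢k refl)
nth-modAt-≢ zero    f (x ∷ T) (suc i) _   = refl
nth-modAt-≢ (suc k) f (x ∷ T) zero    _   = refl
nth-modAt-≢ (suc k) f (x ∷ T) (suc i) i≢k = nth-modAt-≢ k f T i (λ eq → i≢k (cong suc eq))

nth-modAt-≡ : ∀ {A : Set} k (f : A → A) T {R} → nth T k ≡ just R → nth (modAt k f T) k ≡ just (f R)
nth-modAt-≡ zero    f (x ∷ T) refl = refl
nth-modAt-≡ (suc k) f (x ∷ T) e    = nth-modAt-≡ k f T e

modAt-shape : ∀ k (f : List ℕ → List ℕ) → (∀ R → length (f R) ≡ length R) →
              ∀ T → map length (modAt k f T) ≡ map length T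
modAt-shape k       f same []      = refl
modAt-shape zero    f same (x ∷ T) = cong (_∷ map length T) (same x)
modAt-shape (suc k) f same (x ∷ T) = cong (length x ∷_) (modAt-shape k f same T)

module CellUpdate {T : Tab} (dT : IsDecreasingTableau T) {k : ℕ} {R : List ℕ} (row-at : nth T k ≡ just R)
                  {j a : ℕ} (a-at : nth R j ≡ just a) (b : ℕ) where

  open IsDecreasingTableau dT

  T' : Tab
  T' = modAt k (replaceVal a b) T

  first : FirstAt a j R
  first = a-at , λ i i<j ei → decreasing-< R (row-decreasing dT k row-at) i<j ei a-at

  other-rows : ∀ i → i ≢ k → nth T' i ≡ nth T i
  other-rows = nth-modAt-≢ k (replaceVal a b) T

  row-at' : nth T' k ≡ just (replaceVal a b R)
  row-at' = nth-modAt-≡ k (replaceVal a b) T row-at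

  entry-T' : ∀ i j' → (i ≡ k × j' ≡ j × entry T' i j' ≡ just b) ⊎ ((i ≢ k ⊎ j' ≢ j) × entry T' i j' ≡ entry T i j')
  entry-T' i j' with i ≟ k
  ... | no i≢k = inj₂ (inj₁ i≢k , entry-cong T T' i j' (other-rows i i≢k))
  ... | yes refl with j' ≟ j
  ...   | yes refl = inj₁ (refl , refl , trans (entry-nth T' i j' row-at') (nth-replaceVal-≡ a b R j first))
  ...   | no j'≢j  = inj₂ (inj₂ j'≢j , trans (entry-nth T' i j' row-at')
                             (trans (nth-replaceVal-≢ a b R j first j' j'≢j) (sym (entry-nth T i j' row-at))))

  shape : map length T' ≡ map length T
  shape = modAt-shape k (replaceVal a b) (replaceVal-length a b) T

  -- Only the right and lower neighbours need a hypothesis: the left and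
  -- upper ones exceed a, hence b.
  decreasing : b < a → 0 < b → (∀ {v} → nth R (suc j) ≡ just v → v < b) →
               (∀ {v} → entry T (suc k) j ≡ just v → v < b) → IsDecreasingTableau T'
  decreasing b<a 0<b right below = record
    { rowsNonempty = rowsNonempty-sameShape shape rowsNonempty
    ; shapePartition = shapePartition-sameShape shape dT
    ; positive = positive'
    ; rowStrict = rowStrict'
    ; colStrict = colStrict' }
    where
    a-entry : entry T k j ≡ just a
    a-entry = trans (entry-nth T k j row-at) a-at

    positive' : ∀ i j' v → entry T' i j' ≡ just v → 0 < v
    positive' i j' v e with entry-T' i j'
    ... | inj₁ (_ , _ , eb) = subst (0 <_) (just-injective (trans (sym eb) e)) 0<b
    ... | inj₂ (_ , same)   = positive i j' v (trans (sym same) e)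

    rowStrict' : ∀ i j' u v → entry T' i j' ≡ just u → entry T' i (suc j') ≡ just v → v < u
    rowStrict' i j' u v eu ev with entry-T' i j' | entry-T' i (suc j')
    ... | inj₁ (_ , j'≡j , _) | inj₁ (_ , sj'≡j , _) = ⊥-elim (1+n≢n (trans sj'≡j (sym j'≡j)))
    ... | inj₁ (refl , refl , eb) | inj₂ (_ , same) =
          subst (v <_) (just-injective (trans (sym eb) eu))
            (right (trans (sym (entry-nth T k (suc j) row-at)) (trans (sym same) ev)))
    ... | inj₂ (_ , same) | inj₁ (refl , refl , eb) =
          subst (_< u) (just-injective (trans (sym eb) ev))
            (<-trans b<a (rowStrict i j' u a (trans (sym same) eu) a-entry))
    ... | inj₂ (_ , same) | inj₂ (_ , same') = rowStrict i j' u v (trans (sym same) eu) (trans (sym same') ev)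

    colStrict' : ∀ i j' u v → entry T' i j' ≡ just u → entry T' (suc i) j' ≡ just v → v < u
    colStrict' i j' u v eu ev with entry-T' i j' | entry-T' (suc i) j'
    ... | inj₁ (i≡k , _ , _) | inj₁ (si≡k , _ , _) = ⊥-elim (1+n≢n (trans si≡k (sym i≡k)))
    ... | inj₁ (refl , refl , eb) | inj₂ (_ , same) =
          subst (v <_) (just-injective (trans (sym eb) eu)) (below (trans (sym same) ev))
    ... | inj₂ (_ , same) | inj₁ (refl , refl , eb) =
          subst (_< u) (just-injective (trans (sym eb) ev))
            (<-trans b<a (colStrict i j' u a (trans (sym same) eu) a-entry))
    ... | inj₂ (_ , same) | inj₂ (_ , same') = colStrict i j' u v (trans (sym same) eu) (trans (sym same') ev)

-- Deleting a corner

record Corner (T : Tab) (k c : ℕ) : Set where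
  field
    row           : List ℕ
    row-at        : nth T k ≡ just row
    row-length    : length row ≡ suc c
    nothing-below : entry T (suc k) c ≡ nothing
    value         : ℕ
    value-at      : nth row c ≡ just value

  entry-at : entry T k c ≡ just value
  entry-at = trans (entry-nth T k c row-at) value-at

removable⇒corner : ∀ {T k c} → Removable T (suc k) (suc c) → Corner T k c
removable⇒corner {c = c} (_ , _ , (row , row-at , row-length) , nothing-below) = record
  { row = row ; row-at = row-at ; row-length = row-length ; nothing-below = nothing-below
  ; value = proj₁ last ; value-at = proj₂ last }
  where
  last : ∃ λ v → nth row c ≡ just v
  last = nth-defined row c (subst (c <_) (sym row-length) (n<1+n c))

nonEmpty : List ℕ → Maybe (List ℕ)
nonEmpty []       = nothing
nonEmpty (x ∷ xs) = just (x ∷ xs)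

nonEmpty-just : ∀ xs {ys} → nonEmpty xs ≡ just ys → xs ≡ ys × 0 < length ys
nonEmpty-just (x ∷ xs) refl = refl , s≤s z≤n

removeAt-length : ∀ (R : List ℕ) j → j < length R → length (removeAtℕ j R) ≡ length R ∸ 1
removeAt-length (x ∷ xs)       zero    _         = refl
removeAt-length (x ∷ (y ∷ ys)) (suc j) (s≤s j<n) = cong suc (removeAt-length (y ∷ ys) j j<n)

nth-removeAt-< : ∀ (R : List ℕ) j i → i < j → nth (removeAtℕ j R) i ≡ nth R i
nth-removeAt-< []       j       i       _         = refl
nth-removeAt-< (x ∷ xs) (suc j) zero    _         = refl
nth-removeAt-< (x ∷ xs) (suc j) (suc i) (s≤s i<j) = nth-removeAt-< xs j i i<j

-- A row emptied by the deletion is dropped, which shifts the rows below it;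
-- hence the hypothesis that there are none.
nth-deleteCell : ∀ T k j {R} → nth T k ≡ just R → (removeAtℕ j R ≡ [] → nth T (suc k) ≡ nothing) →
  (∀ i → i ≢ k → nth (deleteCell T k j) i ≡ nth T i) × nth (deleteCell T k j) k ≡ nonEmpty (removeAtℕ j R)
nth-deleteCell (R ∷ T) zero j refl last with removeAtℕ j R
nth-deleteCell (R ∷ [])      zero j refl last | []     = (λ { zero i≢0 → ⊥-elim (i≢0 refl) ; (suc i) _ → refl }) , refl
nth-deleteCell (R ∷ (_ ∷ T)) zero j refl last | []     = ⊥-elim (just≢nothing (last refl))
nth-deleteCell (R ∷ T)       zero j refl last | y ∷ ys = (λ { zero i≢0 → ⊥-elim (i≢0 refl) ; (suc i) _ → refl }) , refl
nth-deleteCell (R ∷ T) (suc k) j e last with nth-deleteCell T k j e last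
... | others , here = (λ { zero _ → refl ; (suc i) i≢k → others i (λ eq → i≢k (cong suc eq)) }) , here

deleteCell-shape : ∀ T k j {R} → nth T k ≡ just R → j < length R →
                   map length (deleteCell T k j) ≡ shapeDel (map length T) (suc k)
deleteCell-shape (R ∷ T) zero j refl j<n with removeAtℕ j R | length R ∸ 1 | removeAt-length R j j<n
... | []     | zero  | _ = refl
... | x ∷ xs | suc n | p = cong (_∷ map length T) p
deleteCell-shape (R ∷ T) (suc k) j e j<n = cong (length R ∷_) (deleteCell-shape T k j e j<n)

module Deletion {T : Tab} (dT : IsDecreasingTableau T) {k c : ℕ} (corner : Corner T k c) where

  open IsDecreasingTableau dT
  open Corner corner

  T₁ : Tab
  T₁ = deleteCell T k c

  c<length : c < length row
  c<length = subst (c <_) (sym row-length) (n<1+n c)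

  shortened-length : length (removeAtℕ c row) ≡ c
  shortened-length = trans (removeAt-length row c c<length) (cong (_∸ 1) row-length)

  row-below-short : ∀ {R} → nth T (suc k) ≡ just R → length R ≤ c
  row-below-short {R} e = nth-undefined⇒length≤ R c (trans (sym (entry-nth T (suc k) c e)) nothing-below)

  no-row-below : removeAtℕ c row ≡ [] → nth T (suc k) ≡ nothing
  no-row-below emptied with nth T (suc k) in e
  ... | nothing = refl
  ... | just R  = ⊥-elim (<⇒≱ (All-nth rowsNonempty (suc k) e) (subst (length R ≤_) c≡0 (row-below-short e)))
    where
    c≡0 : c ≡ 0
    c≡0 = trans (sym shortened-length) (cong length emptied)

  other-rows : ∀ i → i ≢ k → nth T₁ i ≡ nth T i
  other-rows = proj₁ (nth-deleteCell T k c row-at no-row-below)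

  nth-T₁-k : ∀ {R} → nth T₁ k ≡ just R → removeAtℕ c row ≡ R × 0 < length R
  nth-T₁-k e = nonEmpty-just _ (trans (sym (proj₂ (nth-deleteCell T k c row-at no-row-below))) e)

  entry-T₁⇒entry-T : ∀ i j {v} → entry T₁ i j ≡ just v → entry T i j ≡ just v
  entry-T₁⇒entry-T i j e with i ≟ k
  ... | no i≢k = trans (sym (entry-cong T T₁ i j (other-rows i i≢k))) e
  ... | yes refl with entry⇒nth T₁ i j e
  ...   | R , R-at , v-at with nth-T₁-k R-at
  ...     | refl , _ = trans (entry-nth T i j row-at)
                         (trans (sym (nth-removeAt-< row c j (subst (j <_) shortened-length (nth-length R j v-at)))) v-at)

  row-k-shortened : ∀ j {v} → c ≤ j → entry T₁ k j ≢ just v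
  row-k-shortened j c≤j e with entry⇒nth T₁ k j e
  ... | R , R-at , v-at with nth-T₁-k R-at
  ...   | refl , _ = <⇒≱ (subst (j <_) shortened-length (nth-length R j v-at)) c≤j

  shape : map length T₁ ≡ shapeDel (map length T) (suc k)
  shape = deleteCell-shape T k c row-at c<length

  decreasing : IsDecreasingTableau T₁
  decreasing = record
    { rowsNonempty = nth⇒All T₁ nonempty
    ; shapePartition = partition
    ; positive = λ i j v e → positive i j v (entry-T₁⇒entry-T i j e)
    ; rowStrict = λ i j u v eu ev → rowStrict i j u v (entry-T₁⇒entry-T i j eu) (entry-T₁⇒entry-T i (suc j) ev)
    ; colStrict = λ i j u v eu ev → colStrict i j u v (entry-T₁⇒entry-T i j eu) (entry-T₁⇒entry-T (suc i) j ev) }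
    where
    nonempty : ∀ i {R} → nth T₁ i ≡ just R → 0 < length R
    nonempty i e with i ≟ k
    ... | no i≢k  = All-nth rowsNonempty i (trans (sym (other-rows i i≢k)) e)
    ... | yes refl = proj₂ (nth-T₁-k e)

    partition : ∀ i R R' → nth T₁ i ≡ just R → nth T₁ (suc i) ≡ just R' → length R' ≤ length R
    partition i R R' e e' with i ≟ k | suc i ≟ k
    ... | yes refl | _ with nth-T₁-k e
    ...   | refl , _ = subst (length R' ≤_) (sym shortened-length)
                         (row-below-short (trans (sym (other-rows (suc i) (λ eq → 1+n≢n eq))) e'))
    partition i R R' e e' | no i≢k | no si≢k =
      shapePartition i R R' (trans (sym (other-rows i i≢k)) e) (trans (sym (other-rows (suc i) si≢k)) e')
    partition i R R' e e' | no i≢k | yes refl with nth-T₁-k e'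
    ... | refl , _ = ≤-trans (subst (_≤ length row) (sym shortened-length) (subst (c ≤_) (sym row-length) (n≤1+n c)))
                       (shapePartition i R row (trans (sym (other-rows i i≢k)) e) row-at)

-- Reverse insertion

ReturnsTableau : Maybe (Tab × ℕ) → List ℕ → Set
ReturnsTableau result shape =
  ∃ λ P' → ∃ λ m → result ≡ just (P' , m) × IsDecreasingTableau P' × map length P' ≡ shape

returns-bind : ∀ {A : Set} {x : Maybe A} {a : A} {f : A → Maybe (Tab × ℕ)} {shape} →
               x ≡ just a → ReturnsTableau (f a) shape → ReturnsTableau (x >>= f) shape
returns-bind refl returns = returns

returns-reshape : ∀ {result shape shape'} → shape ≡ shape' → ReturnsTableau result shape → ReturnsTableau result shape'
returns-reshape refl returns = returns

data RowRule (P' : Tab) (k : ℕ) (R : List ℕ) (mᵢ mᵢ₊₁ : ℕ) (αᵢ₊₁ : Bool) : Tab × Bool → Set where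
  D  : elemᵇ (mᵢ ∸ 1) R ≡ true → RowRule P' k R mᵢ mᵢ₊₁ αᵢ₊₁ (P' , αᵢ₊₁)
  DR : αᵢ₊₁ ≡ true → elemᵇ mᵢ₊₁ R ≡ false → RowRule P' k R mᵢ mᵢ₊₁ αᵢ₊₁ (modAt k (replaceVal mᵢ mᵢ₊₁) P' , true)
  IR : ∀ x → mᵢ₊₁ < x × x < mᵢ → RowRule P' k R mᵢ mᵢ₊₁ αᵢ₊₁ (modAt k (replaceVal mᵢ x) P' , true)
  NR : RowRule P' k R mᵢ mᵢ₊₁ αᵢ₊₁ (P' , false)

rowRule : ∀ P' k R mᵢ mᵢ₊₁ αᵢ₊₁ → RowRule P' k R mᵢ mᵢ₊₁ αᵢ₊₁ (processRow P' k R mᵢ mᵢ₊₁ αᵢ₊₁)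
rowRule P' k R mᵢ mᵢ₊₁ αᵢ₊₁
  with elemᵇ (mᵢ ∸ 1) R in d | αᵢ₊₁ | elemᵇ mᵢ₊₁ R in e | smallestIn (ejectable (drop (suc k) P')) mᵢ₊₁ mᵢ in s
... | true  | _     | _     | _       = D d
... | false | true  | false | _       = DR refl e
... | false | true  | true  | just x  = IR x (smallestIn-bounds _ mᵢ₊₁ mᵢ s)
... | false | false | _     | just x  = IR x (smallestIn-bounds _ mᵢ₊₁ mᵢ s)
... | false | true  | true  | nothing = NR
... | false | false | _     | nothing = NR

∸1< : ∀ {m} → 0 < m → m ∸ 1 < m
∸1< {suc m} _ = n<1+n m

∸1<⇒≤ : ∀ {m w} → 0 < m → m ∸ 1 < w → m ≤ w
∸1<⇒≤ {suc m} _ m<w = m<w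

module Sweep (P : Tab) (dP : IsDecreasingTableau P) where

  open IsDecreasingTableau dP

  entry-positive : ∀ i {R} j {v} → nth P i ≡ just R → nth R j ≡ just v → 0 < v
  entry-positive i j R-at v-at = positive i j _ (trans (entry-nth P i j R-at) v-at)

  -- The state before processing the (0-based) row k, i.e. the paper's row i;
  -- mᵢ sits at column col of row k of P.
  record Invariant (P' : Tab) (k mᵢ mᵢ₊₁ : ℕ) (αᵢ₊₁ : Bool) : Set where
    field
      decreasing    : IsDecreasingTableau P'
      agrees-above  : ∀ i → i ≤ k → nth P' i ≡ nth P i
      row           : List ℕ
      row-at        : nth P k ≡ just row
      col           : ℕ
      bumped-at     : nth row col ≡ just mᵢ
      bumped-least  : ∀ j {v} → nth row j ≡ just v → mᵢ₊₁ < v → mᵢ ≤ v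
      below-bumped  : mᵢ₊₁ < mᵢ
      under-≤       : ∀ {v} → entry P' (suc k) col ≡ just v → v ≤ mᵢ₊₁
      under-<       : αᵢ₊₁ ≡ true → elemᵇ mᵢ₊₁ row ≡ false → ∀ {v} → entry P' (suc k) col ≡ just v → v < mᵢ₊₁
      positive-if-α : αᵢ₊₁ ≡ true → 0 < mᵢ₊₁

  record RowProcessed (P' : Tab) (k mᵢ col : ℕ) (row : List ℕ) (out : Tab × Bool) : Set where
    field
      decreasing : IsDecreasingTableau (proj₁ out)
      same-shape : map length (proj₁ out) ≡ map length P'
      other-rows : ∀ i → i ≢ k → nth (proj₁ out) i ≡ nth P' i
      right-≤    : ∀ j {v} → col ≤ j → entry (proj₁ out) k j ≡ just v → v ≤ mᵢ
      -- the second alternative is a rule (D) step, which keeps mᵢ at col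
      right-<    : proj₂ out ≡ true → ∀ j {v} → col ≤ j → entry (proj₁ out) k j ≡ just v →
                   v < mᵢ ⊎ (j ≡ col × ∃ λ p → nth row p ≡ just (mᵢ ∸ 1))

  process-row : ∀ {P' k mᵢ mᵢ₊₁ αᵢ₊₁} (inv : Invariant P' k mᵢ mᵢ₊₁ αᵢ₊₁) →
    RowProcessed P' k mᵢ (Invariant.col inv) (Invariant.row inv) (processRow P' k (Invariant.row inv) mᵢ mᵢ₊₁ αᵢ₊₁)
  process-row {P'} {k} {mᵢ} {mᵢ₊₁} {αᵢ₊₁} inv = by-rule (rowRule P' k row mᵢ mᵢ₊₁ αᵢ₊₁)
    where
    open Invariant inv

    row-at' : nth P' k ≡ just row
    row-at' = trans (agrees-above k ≤-refl) row-at

    row-decr : Decreasing row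
    row-decr = row-decreasing dP k row-at

    entry-row : ∀ j → entry P' k j ≡ nth row j
    entry-row j = entry-nth P' k j row-at'

    right-neighbour : ∀ {v} → nth row (suc col) ≡ just v → v ≤ mᵢ₊₁
    right-neighbour e = ≮⇒≥ (λ mᵢ₊₁<v → <⇒≱ (row-decr col bumped-at e) (bumped-least (suc col) e mᵢ₊₁<v))

    kept-right-≤ : ∀ j {v} → col ≤ j → entry P' k j ≡ just v → v ≤ mᵢ
    kept-right-≤ j col≤j e = decreasing-≤ row row-decr col≤j bumped-at (trans (sym (entry-row j)) e)

    replaced : ∀ y → y < mᵢ → 0 < y → (∀ {v} → nth row (suc col) ≡ just v → v < y) →
               (∀ {v} → entry P' (suc k) col ≡ just v → v < y) →
               RowProcessed P' k mᵢ col row (modAt k (replaceVal mᵢ y) P' , true)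
    replaced y y<mᵢ 0<y right below = record
      { decreasing = U.decreasing y<mᵢ 0<y right below
      ; same-shape = U.shape
      ; other-rows = U.other-rows
      ; right-≤ = λ j col≤j e → <⇒≤ (smaller j col≤j e)
      ; right-< = λ _ j col≤j e → inj₁ (smaller j col≤j e) }
      where
      module U = CellUpdate decreasing row-at' bumped-at y
      smaller : ∀ j {v} → col ≤ j → entry U.T' k j ≡ just v → v < mᵢ
      smaller j col≤j e with U.entry-T' k j
      ... | inj₁ (_ , _ , ey) = subst (_< mᵢ) (just-injective (trans (sym ey) e)) y<mᵢ
      ... | inj₂ (inj₁ k≢k , _) = ⊥-elim (k≢k refl)
      ... | inj₂ (inj₂ j≢col , same) =
            decreasing-< row row-decr (≤∧≢⇒< col≤j (λ eq → j≢col (sym eq))) bumped-at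
              (trans (sym (entry-row j)) (trans (sym same) e))

    by-rule : ∀ {out} → RowRule P' k row mᵢ mᵢ₊₁ αᵢ₊₁ out → RowProcessed P' k mᵢ col row out
    by-rule (D d) = record
      { decreasing = decreasing ; same-shape = refl ; other-rows = λ _ _ → refl
      ; right-≤ = kept-right-≤ ; right-< = λ _ → kept-right-< }
      where
      kept-right-< : ∀ j {v} → col ≤ j → entry P' k j ≡ just v → v < mᵢ ⊎ (j ≡ col × ∃ λ p → nth row p ≡ just (mᵢ ∸ 1))
      kept-right-< j col≤j e with m≤n⇒m<n∨m≡n col≤j
      ... | inj₁ col<j = inj₁ (decreasing-< row row-decr col<j bumped-at (trans (sym (entry-row j)) e))
      ... | inj₂ col≡j = inj₂ (sym col≡j , elemᵇ-true⇒nth _ row d)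
    by-rule NR = record
      { decreasing = decreasing ; same-shape = refl ; other-rows = λ _ _ → refl
      ; right-≤ = kept-right-≤ ; right-< = λ () }
    by-rule (DR α e) = replaced mᵢ₊₁ below-bumped (positive-if-α α)
      (λ e' → ≤∧≢⇒< (right-neighbour e') (λ v≡mᵢ₊₁ → elemᵇ-false⇒nth mᵢ₊₁ row e (suc col) (subst (λ v → nth row (suc col) ≡ just v) v≡mᵢ₊₁ e')))
      (under-< α e)
    by-rule (IR x (mᵢ₊₁<x , x<mᵢ)) = replaced x x<mᵢ (≤-<-trans z≤n mᵢ₊₁<x)
      (λ e → ≤-<-trans (right-neighbour e) mᵢ₊₁<x) (λ e → ≤-<-trans (under-≤ e) mᵢ₊₁<x)

  record BumpAbove (k col m : ℕ) : Set where
    field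
      row      : List ℕ
      row-at   : nth P k ≡ just row
      m'       : ℕ
      found    : smallestAbove row m ≡ just m'
      col'     : ℕ
      m'-at    : nth row col' ≡ just m'
      m<m'     : m < m'
      col≤col' : col ≤ col'

  cell-above : ∀ k {R R'} col {m} → nth P (suc k) ≡ just R → nth P k ≡ just R' → nth R col ≡ just m →
               ∃ λ w → nth R' col ≡ just w × m < w
  cell-above k {R} {R'} col R-at R'-at m-at with nth-defined R' col (≤-trans (nth-length R col m-at) (shapePartition k R' R R'-at R-at))
  ... | w , w-at = w , w-at , colStrict k col w _ (trans (entry-nth P k col R'-at) w-at) (trans (entry-nth P (suc k) col R-at) m-at)

  bump-above : ∀ k {R} col {m} → nth P (suc k) ≡ just R → nth R col ≡ just m → BumpAbove k col m
  bump-above k col {m} R-at m-at with nth-defined-≤ P (n≤1+n k) R-at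
  ... | R' , R'-at with cell-above k col R-at R'-at m-at
  ...   | w , w-at , m<w with smallestAbove-defined R' m col w-at m<w
  ...     | m' , found with smallestAbove-∈ R' m found
  ...       | col' , m'-at , m<m' = record
    { row = R' ; row-at = R'-at ; m' = m' ; found = found ; col' = col' ; m'-at = m'-at ; m<m' = m<m'
    ; col≤col' = ≮⇒≥ λ col'<col →
        <⇒≱ (decreasing-< R' (row-decreasing dP k R'-at) col'<col m'-at w-at) (smallestAbove-least R' m found col w-at m<w) }

  -- If col' were col, the cell above the right neighbour of m would hold a
  -- value strictly between m and m'.
  bump-right-of-predecessor : ∀ k {R} col {m} → nth P (suc k) ≡ just R → nth R col ≡ just m →
    ∀ {p} → nth R p ≡ just (m ∸ 1) → (b : BumpAbove k col m) → elemᵇ m (BumpAbove.row b) ≡ false →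
    BumpAbove.col' b ≢ col
  bump-right-of-predecessor k {R} col {m} R-at m-at {p} p-at b absent col'≡col = <⇒≱ w<m' m'≤w
    where
    open BumpAbove b
    R-decr : Decreasing R
    R-decr = row-decreasing dP (suc k) R-at
    0<m : 0 < m
    0<m = entry-positive (suc k) col R-at m-at
    col<p : col < p
    col<p = decreasing-<⁻¹ R R-decr col p m-at p-at (∸1< 0<m)
    right : ∃ λ u → nth R (suc col) ≡ just u
    right = nth-defined-≤ R col<p p-at
    above-right : ∃ λ w → nth row (suc col) ≡ just w × proj₁ right < w
    above-right = cell-above k (suc col) R-at row-at (proj₂ right)
    w : ℕ
    w = proj₁ above-right
    w-at : nth row (suc col) ≡ just w
    w-at = proj₁ (proj₂ above-right)
    m≤w : m ≤ w
    m≤w = ∸1<⇒≤ 0<m (≤-<-trans (decreasing-≤ R R-decr col<p (proj₂ right) p-at) (proj₂ (proj₂ above-right)))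
    m<w : m < w
    m<w = ≤∧≢⇒< m≤w (λ m≡w → elemᵇ-false⇒nth m row absent (suc col) (subst (λ v → nth row (suc col) ≡ just v) (sym m≡w) w-at))
    m'≤w : m' ≤ w
    m'≤w = smallestAbove-least row m found (suc col) w-at m<w
    w<m' : w < m'
    w<m' = row-decreasing dP k row-at col (subst (λ j → nth row j ≡ just m') col'≡col m'-at) w-at

  bump-invariant : ∀ {P' k col m αᵢ₊₁} (b : BumpAbove k col m) → IsDecreasingTableau P' →
    (∀ i → i ≤ k → nth P' i ≡ nth P i) →
    (∀ j {v} → col ≤ j → entry P' (suc k) j ≡ just v → v ≤ m) →
    (αᵢ₊₁ ≡ true → elemᵇ m (BumpAbove.row b) ≡ false → ∀ {v} → entry P' (suc k) (BumpAbove.col' b) ≡ just v → v < m) →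
    0 < m → Invariant P' k (BumpAbove.m' b) m αᵢ₊₁
  bump-invariant {m = m} b dP' agrees under-≤ under-< 0<m = record
    { decreasing = dP' ; agrees-above = agrees ; row = row ; row-at = row-at ; col = col' ; bumped-at = m'-at
    ; bumped-least = smallestAbove-least row m found ; below-bumped = m<m'
    ; under-≤ = under-≤ col' col≤col' ; under-< = under-< ; positive-if-α = λ _ → 0<m }
    where open BumpAbove b

  sweep-sound : ∀ k {P' mᵢ mᵢ₊₁ αᵢ₊₁} → Invariant P' k mᵢ mᵢ₊₁ αᵢ₊₁ →
                ReturnsTableau (sweep P P' k mᵢ mᵢ₊₁ αᵢ₊₁) (map length P')
  sweep-sound zero {P'} {mᵢ} {mᵢ₊₁} {αᵢ₊₁} inv =
    returns-bind (Invariant.row-at inv) (_ , _ , refl , RowProcessed.decreasing done , RowProcessed.same-shape done)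
    where
    done : RowProcessed P' zero mᵢ (Invariant.col inv) (Invariant.row inv) (processRow P' zero (Invariant.row inv) mᵢ mᵢ₊₁ αᵢ₊₁)
    done = process-row inv
  sweep-sound (suc k) {P'} {mᵢ} {mᵢ₊₁} {αᵢ₊₁} inv =
    returns-bind row-at (returns-bind B.row-at (returns-bind B.found
      (returns-reshape R.same-shape (sweep-sound k next))))
    where
    open Invariant inv
    out : Tab × Bool
    out = processRow P' (suc k) row mᵢ mᵢ₊₁ αᵢ₊₁
    module R = RowProcessed (process-row inv)
    bump : BumpAbove k col mᵢ
    bump = bump-above k col row-at bumped-at
    module B = BumpAbove bump

    under-next : proj₂ out ≡ true → elemᵇ mᵢ B.row ≡ false → ∀ {v} → entry (proj₁ out) (suc k) B.col' ≡ just v → v < mᵢ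
    under-next changed absent e with R.right-< changed B.col' B.col≤col' e
    ... | inj₁ v<mᵢ = v<mᵢ
    ... | inj₂ (col'≡col , _ , p-at) = ⊥-elim (bump-right-of-predecessor k col row-at bumped-at p-at bump absent col'≡col)

    next : Invariant (proj₁ out) k B.m' mᵢ (proj₂ out)
    next = bump-invariant bump R.decreasing
      (λ i i≤k → trans (R.other-rows i (λ i≡sk → <-irrefl i≡sk (s≤s i≤k))) (agrees-above i (m≤n⇒m≤1+n i≤k)))
      R.right-≤ under-next (entry-positive (suc k) col row-at bumped-at)

  start-invariant : ∀ {k c} (corner : Corner P k c) → Invariant P k (Corner.value corner) 0 false
  start-invariant {k} {c} corner = record
    { decreasing = dP ; agrees-above = λ _ _ → refl ; row = row ; row-at = row-at ; col = c ; bumped-at = value-at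
    ; bumped-least = λ j e _ →
        decreasing-≤ row (row-decreasing dP k row-at) (≤-pred (subst (j <_) row-length (nth-length row j e))) e value-at
    ; below-bumped = positive k c value entry-at
    ; under-≤ = λ e → ⊥-elim (just≢nothing (trans (sym e) nothing-below))
    ; under-< = λ ()
    ; positive-if-α = λ () }
    where open Corner corner

  deletion-invariant : ∀ {k c} (corner : Corner P (suc k) c) →
    let b = bump-above k c (Corner.row-at corner) (Corner.value-at corner) in
    Invariant (deleteCell P (suc k) c) k (BumpAbove.m' b) (Corner.value corner) true
  deletion-invariant {k} {c} corner =
    bump-invariant (bump-above k c row-at value-at) D.decreasing
      (λ i i≤k → D.other-rows i (λ i≡sk → <-irrefl i≡sk (s≤s i≤k)))
      (λ j c≤j e → ⊥-elim (D.row-k-shortened j c≤j e))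
      (λ _ _ e → ⊥-elim (D.row-k-shortened _ (BumpAbove.col≤col' (bump-above k c row-at value-at)) e))
      (entry-positive (suc k) c row-at value-at)
    where
    open Corner corner
    module D = Deletion dP corner

theorem3p2 : (P : Tab) (r c : ℕ) (α : Bool) →
    IsDecreasingTableau P → Removable P r c →
    Σ Tab λ P' → Σ ℕ λ m →
      (Ψ P r c α ≡ just (P' , m)) × IsDecreasingTableau P' ×
      (map length P' ≡ (if α then shapeDel (map length P) r else map length P))
theorem3p2 P zero c α dP (() , _)
theorem3p2 P (suc k) zero α dP (_ , () , _)
theorem3p2 P (suc k) (suc c) false dP removable =
  returns-bind entry-at (sweep-sound k (start-invariant corner))
  where
  open Sweep P dP
  corner : Corner P k c
  corner = removable⇒corner removable
  open Corner corner
theorem3p2 P (suc zero) (suc c) true dP removable =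
  returns-bind entry-at (_ , _ , refl , D.decreasing , D.shape)
  where
  corner : Corner P zero c
  corner = removable⇒corner removable
  open Corner corner
  module D = Deletion dP corner
theorem3p2 P (suc (suc k)) (suc c) true dP removable =
  returns-bind entry-at (returns-bind B.row-at (returns-bind B.found
    (returns-reshape D.shape (sweep-sound k (deletion-invariant corner)))))
  where
  open Sweep P dP
  corner : Corner P (suc k) c
  corner = removable⇒corner removable
  open Corner corner
  module D = Deletion dP corner
  module B = BumpAbove (bump-above k c row-at value-at)
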